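{- Let $q\ge 3$ be an integer and let $H$ be a $q$-necklace with chain $u_1u_2\cdots u_n$. Let $(S,\Omega)$ be a society, where $\bar\Omega=\{w_1,\ldots,w_n\}$ listed in the cyclic order $\Omega$, and suppose $(S,\Omega)$ has a vortical decomposition $(t_1t_2\cdots t_n,\mathcal{X})$ of width $w$. If $G$ is the multigraph obtained from the disjoint union of $S$ and $H$ by identifying $u_i$ with the $i$-th vertex $w_i$ of $\Omega$ for each $1\le i\le n$, then $G$ has tree-width at most $q(w+1)-1$.
   Context: For an integer $q>0$, a $q$-necklace with chain $v_1v_2\cdots v_n$ is a multigraph $G$ with $V(G)=\{v_1,\ldots,v_n\}$ such that: (1) $v_1v_2\cdots v_nv_1$ is a cycle $C$ of $G$; (2) $G$ contains pairwise edge-disjoint complete subgraphs $M_1,\ldots,M_k$, each having at most $q$ vertices, such that $E(G)-E(C)=\bigcup_{i=1}^k E(M_i)$; (3) there exist no integers $i,j,a,b,c,d$ with $i\ne j$ and $a<b<c<d$ such that $\{v_a,v_c\}\subseteq V(M_i)$ and $\{v_b,v_d\}\subseteq V(M_j)$. A society is a pair $(S,\Omega)$ where $S$ is a graph and $\Omega$ is a cyclic permutation of a subset $\bar\Omega$ of $V(S)$. A path-decomposition is a tree-decomposition whose tree is a path. If $\bar\Omega=\{v_1,\ldots,v_m\}$ in the order $\Omega$, a vortical decomposition of $(S,\Omega)$ is a path-decomposition $(t_1t_2\cdots t_m,\mathcal{X})$ of $S$ whose $i$-th bag (the bag of $t_i$) contains $v_i$ for each $i$. The width of a tree-decomposition is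 the maximum bag size minus one; the tree-width of a multigraph is the minimum width of a tree-decomposition. -}

module Defs where

open import Level using (0ℓ) renaming (suc to lsuc)
open import Data.Nat using (ℕ; zero; suc; _+_; _*_; _∸_; _⊔_; _≤_; _<?_)
import Data.Nat as ℕ
open import Data.Nat.Properties using (1+n≢n)
open import Data.Fin using (Fin; zero; suc; toℕ; fromℕ<; fromℕ; inject₁; splitAt; _<_)
open import Data.Fin.Subset using (Subset; _∈_; _∉_; ∣_∣)
open import Data.Product using (Σ; ∃; ∃-syntax; _×_; _,_; proj₁; proj₂; map)
open import Data.Sum using (_⊎_; inj₁; inj₂; [_,_]′)
open import Data.Unit using (⊤)
open import Data.Empty using (⊥)
open import Relation.Nullary using (¬_; yes; no)
open import Relation.Binary.PropositionalEquality using (_≡_; _≢_; refl; sym; trans)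
open import Function using (_∘_; _⇔_)
open import Function.Definitions using (Injective)

cyc : ∀ {k} → Fin (suc k) → Fin (suc k)
cyc {k} i with suc (toℕ i) <? suc k
... | yes p = fromℕ< p
... | no _  = zero

maxOver : ∀ {t} → (Fin t → ℕ) → ℕ
maxOver {zero}  f = 0
maxOver {suc t} f = f zero ⊔ maxOver (f ∘ suc)

-- Multigraphs on vertex set Fin N: m edges (loops and parallel edges
-- allowed), edge e has ends (ends e).

record Multigraph (N : ℕ) : Set where
  field
    m    : ℕ
    ends : Fin m → Fin N × Fin N
open Multigraph public

Joins : ∀ {N} (G : Multigraph N) → Fin (m G) → Fin N → Fin N → Set
Joins G e a b = ends G e ≡ (a , b) ⊎ ends G e ≡ (b , a)

record Graph (t : ℕ) : Set₁ where
  field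
    _~_   : Fin t → Fin t → Set
    ~-sym : ∀ {x y} → x ~ y → y ~ x
    ~-irr : ∀ {x} → ¬ (x ~ x)
open Graph public

record WalkIn {t} (T : Graph t) (P : Fin t → Set) (x y : Fin t) : Set where
  field
    len   : ℕ
    vtx   : Fin (suc len) → Fin t
    start : vtx zero ≡ x
    end   : vtx (fromℕ len) ≡ y
    steps : ∀ (i : Fin len) → _~_ T (vtx (inject₁ i)) (vtx (suc i))
    inP   : ∀ i → P (vtx i)

ConnectedSet : ∀ {t} → Graph t → (Fin t → Set) → Set
ConnectedSet T P = ∀ x y → P x → P y → WalkIn T P x y

record CycleIn {t} (T : Graph t) : Set where
  field
    k   : ℕ
    vtx : Fin (suc (suc (suc k))) → Fin t
    inj : Injective _≡_ _≡_ vtx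
    adj : ∀ i → _~_ T (vtx i) (vtx (cyc i))

record IsTree {t} (T : Graph t) : Set where
  field
    nonempty  : 0 ℕ.< t
    connected : ConnectedSet T (λ _ → ⊤)
    acyclic   : ¬ CycleIn T

PathGraph : (n : ℕ) → Graph n
PathGraph n = record
  { _~_   = λ i j → toℕ j ≡ suc (toℕ i) ⊎ toℕ i ≡ suc (toℕ j)
  ; ~-sym = λ { (inj₁ p) → inj₂ p ; (inj₂ p) → inj₁ p }
  ; ~-irr = λ { (inj₁ p) → 1+n≢n (sym p) ; (inj₂ p) → 1+n≢n (sym p) }
  }

record TreeDecomposition {N t} (G : Multigraph N) (T : Graph t) : Set where
  field
    isTree    : IsTree T
    bag       : Fin t → Subset N
    coverV    : ∀ v → ∃[ x ] v ∈ bag x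
    coverE    : ∀ e → ∃[ x ] (proj₁ (ends G e) ∈ bag x × proj₂ (ends G e) ∈ bag x)
    connected : ∀ v → ConnectedSet T (λ x → v ∈ bag x)
open TreeDecomposition public

width : ∀ {N t} {G : Multigraph N} {T : Graph t} → TreeDecomposition G T → ℕ
width D = maxOver (λ x → ∣ bag D x ∣) ∸ 1

TreeWidthAtMost : ∀ {N} → Multigraph N → ℕ → Set₁
TreeWidthAtMost G k = ∃[ t ] Σ (Graph t) λ T → Σ (TreeDecomposition G T) λ D → width D ≤ k

PathDecomposition : ∀ {N} → Multigraph N → ℕ → Set
PathDecomposition G n = TreeDecomposition G (PathGraph n)

-- q-necklaces with chain 0,1,...,k (vertex set Fin (suc k))

record CompleteSubgraph {n} (H : Multigraph n) : Set where
  field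
    V       : Subset n
    E       : Subset (m H)
    E-in    : ∀ e → e ∈ E → ∃[ a ] ∃[ b ] (a ≢ b × a ∈ V × b ∈ V × Joins H e a b)
    E-full  : ∀ a b → a ∈ V → b ∈ V → a ≢ b → ∃[ e ] (e ∈ E × Joins H e a b)
    E-uniq  : ∀ e e' a b → e ∈ E → e' ∈ E → Joins H e a b → Joins H e' a b → e ≡ e'
open CompleteSubgraph public

record IsNecklace (q : ℕ) {k : ℕ} (H : Multigraph (suc k)) : Set where
  field
    cycleE      : Fin (suc k) → Fin (m H)
    cycle-inj   : Injective _≡_ _≡_ cycleE
    cycle-joins : ∀ i → Joins H (cycleE i) i (cyc i)
    r           : ℕ
    M           : Fin r → CompleteSubgraph H
    M-small     : ∀ i → ∣ V (M i) ∣ ≤ q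
    M-disjoint  : ∀ i j → i ≢ j → ∀ e → e ∈ E (M i) → e ∉ E (M j)
    M-union     : ∀ e → (¬ (∃[ j ] cycleE j ≡ e)) ⇔ (∃[ i ] e ∈ E (M i))
    noncrossing : ∀ i j → i ≢ j → ∀ a b c d → a < b → b < c → c < d →
                  ¬ (a ∈ V (M i) × c ∈ V (M i) × b ∈ V (M j) × d ∈ V (M j))

-- society (S, Ω) with Ω̄ = {Ω 0, ..., Ω (n-1)} listed in its cyclic order
record Society (N n : ℕ) : Set where
  field
    S     : Multigraph N
    Ω     : Fin n → Fin N
    Ω-inj : Injective _≡_ _≡_ Ω
open Society public

record VorticalDecomposition {N n} (soc : Society N n) : Set where
  field
    pd       : PathDecomposition (S soc) n
    boundary : ∀ i → Ω soc i ∈ bag pd i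
open VorticalDecomposition public

-- disjoint union of S and H with u_i identified with Ω i
glue : ∀ {N n} → (soc : Society N n) → Multigraph n → Multigraph N
glue soc H = record
  { m    = m (S soc) + m H
  ; ends = [ ends (S soc) , map (Ω soc) (Ω soc) ∘ ends H ]′ ∘ splitAt (m (S soc))
  }

module Submission where

-- Let Adj be adjacency in H: two vertices in a common clique M_j, or
-- consecutive on the cycle C = 0 1 … k 0.  First Adj gets a decomposition along
-- a binary tree with bags of at most q vertices: the interval [a, b] of the
-- chain is split at the last vertex c of (a, b) adjacent to a, and the new
-- node's bag is {a, b, c} plus the vertices of (a, b) sharing a clique with
-- both a and b.  Noncrossing puts that bag inside a single clique unless it is
-- {a, b, c}, so it has at most q vertices.  Then each index u is replaced by the
-- bag X_u (substitution): bags grow to at most q(w+1) vertices, and since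
-- consecutive indices are adjacent, the bags containing a vertex of S remain
-- connected.

open import Defs
open import Data.Nat using (ℕ; suc; _+_; _*_; _∸_; _≤_)
open import Relation.Binary.PropositionalEquality using (_≡_)

import Data.Nat as ℕ
open import Data.Nat using (zero; _<_; z≤n; s≤s; _<?_; _≤?_)
open import Data.Nat.Properties
open import Data.Fin using (Fin; zero; suc; toℕ; fromℕ; inject₁; fromℕ<; splitAt; join; _↑ˡ_; _↑ʳ_)
  renaming (_<_ to _<ᶠ_; _≤_ to _≤ᶠ_)
import Data.Fin.Properties as Fin
open import Data.Fin.Properties
  using (toℕ-fromℕ<; toℕ<n; toℕ-fromℕ; toℕ-injective; toℕ-inject₁; splitAt-↑ˡ; splitAt-↑ʳ; join-splitAt)
open import Data.Fin.Subset using (Subset; _∈_; _∪_; ∣_∣; inside; outside; ⊥; _⊆_; ⁅_⁆)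
open import Data.Fin.Subset.Properties
  using (_∈?_; ∉⊥; x∈p∪q⁻; x∈p∪q⁺; ∣⊥∣≡0; p⊆q⇒∣p∣≤∣q∣; x∈⁅x⁆; ∣⁅x⁆∣≡1)
open import Data.Vec using (_∷_; []; tabulate)
open import Data.Vec.Base using (here; there)
open import Data.Vec.Properties using (lookup∘tabulate; []=⇒lookup; lookup⇒[]=)
open import Data.Bool using (if_then_else_)
open import Data.Maybe using (Maybe; just; nothing; maybe)
open import Data.Maybe.Properties using (just-injective)
open import Data.Product using (∃-syntax; _×_; _,_; proj₁; proj₂; map₂)
open import Data.Sum using (_⊎_; inj₁; inj₂; [_,_]′)
open import Data.Unit using (⊤; tt)
open import Data.Empty using (⊥-elim)
open import Function using (_∘_)
open import Function.Bundles using (Equivalence)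
open import Relation.Nullary using (¬_; Dec; yes; no; does)
open import Relation.Nullary.Decidable using (_×-dec_; _⊎-dec_)
open import Relation.Unary using (Decidable)
open import Relation.Binary using (tri<; tri≈; tri>)
open import Relation.Binary.PropositionalEquality using (_≢_; refl; sym; trans; cong; subst; subst₂)

∣p∪q∣≤∣p∣+∣q∣ : ∀ {n} (p r : Subset n) → ∣ p ∪ r ∣ ≤ ∣ p ∣ + ∣ r ∣
∣p∪q∣≤∣p∣+∣q∣ []            []            = z≤n
∣p∪q∣≤∣p∣+∣q∣ (outside ∷ p) (outside ∷ r) = ∣p∪q∣≤∣p∣+∣q∣ p r
∣p∪q∣≤∣p∣+∣q∣ (inside  ∷ p) (outside ∷ r) = s≤s (∣p∪q∣≤∣p∣+∣q∣ p r)
∣p∪q∣≤∣p∣+∣q∣ (inside  ∷ p) (inside  ∷ r) =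
  s≤s (≤-trans (∣p∪q∣≤∣p∣+∣q∣ p r) (+-monoʳ-≤ ∣ p ∣ (n≤1+n ∣ r ∣)))
∣p∪q∣≤∣p∣+∣q∣ (outside ∷ p) (inside  ∷ r) =
  ≤-trans (s≤s (∣p∪q∣≤∣p∣+∣q∣ p r)) (≤-reflexive (sym (+-suc ∣ p ∣ ∣ r ∣)))

⟦_⟧ : ∀ {n} {P : Fin n → Set} → Decidable P → Subset n
⟦ P? ⟧ = tabulate (λ x → if does (P? x) then inside else outside)

∈⟦⟧⁻ : ∀ {n} {P : Fin n → Set} (P? : Decidable P) {x} → x ∈ ⟦ P? ⟧ → P x
∈⟦⟧⁻ P? {x} x∈ with P? x | trans (sym (lookup∘tabulate _ x)) ([]=⇒lookup x∈)
... | yes px | _  = px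
... | no _   | ()

∈⟦⟧⁺ : ∀ {n} {P : Fin n → Set} (P? : Decidable P) {x} → P x → x ∈ ⟦ P? ⟧
∈⟦⟧⁺ P? {x} px = lookup⇒[]= x _ (trans (lookup∘tabulate _ x) (inside-if (P? x)))
  where
  inside-if : (d : Dec _) → (if does d then inside else outside) ≡ inside
  inside-if (yes _) = refl
  inside-if (no ¬px) = ⊥-elim (¬px px)

⋃[_]_ : ∀ {n N} → Subset n → (Fin n → Subset N) → Subset N
⋃[ []          ] f = ⊥
⋃[ inside  ∷ s ] f = f zero ∪ ⋃[ s ] (f ∘ suc)
⋃[ outside ∷ s ] f = ⋃[ s ] (f ∘ suc)

∈⋃⁻ : ∀ {n N} (s : Subset n) (f : Fin n → Subset N) {v} → v ∈ ⋃[ s ] f → ∃[ u ] (u ∈ s × v ∈ f u)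
∈⋃⁻ [] f v∈ = ⊥-elim (∉⊥ v∈)
∈⋃⁻ (inside ∷ s) f v∈ with x∈p∪q⁻ (f zero) (⋃[ s ] (f ∘ suc)) v∈
... | inj₁ v∈f0 = zero , here , v∈f0
... | inj₂ v∈⋃ with ∈⋃⁻ s (f ∘ suc) v∈⋃
...   | u , u∈s , v∈fu = suc u , there u∈s , v∈fu
∈⋃⁻ (outside ∷ s) f v∈ with ∈⋃⁻ s (f ∘ suc) v∈
... | u , u∈s , v∈fu = suc u , there u∈s , v∈fu

∈⋃⁺ : ∀ {n N} (s : Subset n) (f : Fin n → Subset N) {v} u → u ∈ s → v ∈ f u → v ∈ ⋃[ s ] f
∈⋃⁺ (inside  ∷ s) f zero    here       v∈fu = x∈p∪q⁺ (inj₁ v∈fu)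
∈⋃⁺ (inside  ∷ s) f (suc u) (there u∈s) v∈fu = x∈p∪q⁺ (inj₂ (∈⋃⁺ s (f ∘ suc) u u∈s v∈fu))
∈⋃⁺ (outside ∷ s) f (suc u) (there u∈s) v∈fu = ∈⋃⁺ s (f ∘ suc) u u∈s v∈fu

∣⋃∣≤ : ∀ {n N} (s : Subset n) (f : Fin n → Subset N) {B} → (∀ u → ∣ f u ∣ ≤ B) → ∣ ⋃[ s ] f ∣ ≤ ∣ s ∣ * B
∣⋃∣≤ {N = N} []    f small = ≤-reflexive (∣⊥∣≡0 N)
∣⋃∣≤ (inside  ∷ s) f small =
  ≤-trans (∣p∪q∣≤∣p∣+∣q∣ (f zero) _) (+-mono-≤ (small zero) (∣⋃∣≤ s (f ∘ suc) (small ∘ suc)))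
∣⋃∣≤ (outside ∷ s) f small = ∣⋃∣≤ s (f ∘ suc) (small ∘ suc)

∣⊆abc∣≤3 : ∀ {n} (a b c : Fin n) (s : Subset n) → (∀ {v} → v ∈ s → v ≡ a ⊎ v ≡ b ⊎ v ≡ c) → ∣ s ∣ ≤ 3
∣⊆abc∣≤3 a b c s only-abc =
  ≤-trans (p⊆q⇒∣p∣≤∣q∣ s⊆abc)
          (≤-trans (∣p∪q∣≤∣p∣+∣q∣ ⁅ a ⁆ _)
                   (+-mono-≤ (≤-reflexive (∣⁅x⁆∣≡1 a))
                             (≤-trans (∣p∪q∣≤∣p∣+∣q∣ ⁅ b ⁆ _)
                                      (+-mono-≤ (≤-reflexive (∣⁅x⁆∣≡1 b)) (≤-reflexive (∣⁅x⁆∣≡1 c))))))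
  where
  s⊆abc : s ⊆ ⁅ a ⁆ ∪ (⁅ b ⁆ ∪ ⁅ c ⁆)
  s⊆abc v∈s with only-abc v∈s
  ... | inj₁ refl         = x∈p∪q⁺ (inj₁ (x∈⁅x⁆ a))
  ... | inj₂ (inj₁ refl) = x∈p∪q⁺ (inj₂ (x∈p∪q⁺ (inj₁ (x∈⁅x⁆ b))))
  ... | inj₂ (inj₂ refl) = x∈p∪q⁺ (inj₂ (x∈p∪q⁺ (inj₂ (x∈⁅x⁆ c))))

-- Walks along a relation R all of whose vertices satisfy P, as an inductive type.
-- They are easier to compose than the index-based 'WalkIn' of the definitions,
-- to which they convert back and forth ('toWalkIn', 'fromWalkIn').
data Walk {V : Set} (R : V → V → Set) (P : V → Set) : V → V → Set where
  []  : ∀ {x} → P x → Walk R P x x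
  _∷_ : ∀ {x y z} → P x × R x y → Walk R P y z → Walk R P x z

module _ {V : Set} {R : V → V → Set} {P : V → Set} where

  _++_ : ∀ {x y z} → Walk R P x y → Walk R P y z → Walk R P x z
  [] _    ++ ω = ω
  (s ∷ ω) ++ ω′ = s ∷ (ω ++ ω′)

  first : ∀ {x y} → Walk R P x y → P x
  first ([] px)       = px
  first ((px , _) ∷ _) = px

  reverse : (∀ {x y} → R x y → R y x) → ∀ {x y} → Walk R P x y → Walk R P y x
  reverse R-sym ([] px)          = [] px
  reverse R-sym ((px , r) ∷ ω) = reverse R-sym ω ++ ((first ω , R-sym r) ∷ [] px)

mapWalk : ∀ {V V′ : Set} {R : V → V → Set} {P : V → Set} {R′ : V′ → V′ → Set} {P′ : V′ → Set}
          (f : V → V′) → (∀ {x y} → R x y → R′ (f x) (f y)) → (∀ {x} → P x → P′ (f x)) →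
          ∀ {x y} → Walk R P x y → Walk R′ P′ (f x) (f y)
mapWalk f f-R f-P ([] px)          = [] (f-P px)
mapWalk f f-R f-P ((px , r) ∷ ω) = (f-P px , f-R r) ∷ mapWalk f f-R f-P ω

weaken : ∀ {V : Set} {R : V → V → Set} {P P′ : V → Set} → (∀ {x} → P x → P′ x) →
         ∀ {x y} → Walk R P x y → Walk R P′ x y
weaken = mapWalk (λ x → x) (λ r → r)

Linked : ∀ {V : Set} → (V → V → Set) → (V → Set) → Set
Linked {V} R P = ∀ (x y : V) → P x → P y → Walk R P x y

module _ {t} (T : Graph t) {P : Fin t → Set} where

  private
    Walkᵀ = Walk (_~_ T) P

  length : ∀ {x y} → Walkᵀ x y → ℕ
  length ([] _)  = 0
  length (_ ∷ ω) = suc (length ω)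

  vertex : ∀ {x y} (ω : Walkᵀ x y) → Fin (suc (length ω)) → Fin t
  vertex {x} ω       zero    = x
  vertex     (_ ∷ ω) (suc i) = vertex ω i

  toWalkIn : ∀ {x y} → Walkᵀ x y → WalkIn T P x y
  toWalkIn ω = record
    { len = length ω ; vtx = vertex ω ; start = refl ; end = end ω ; steps = steps ω ; inP = inP ω }
    where
    end : ∀ {x y} (ω : Walkᵀ x y) → vertex ω (fromℕ (length ω)) ≡ y
    end ([] _)  = refl
    end (_ ∷ ω) = end ω
    steps : ∀ {x y} (ω : Walkᵀ x y) (i : Fin (length ω)) → _~_ T (vertex ω (inject₁ i)) (vertex ω (suc i))
    steps ((_ , r) ∷ [] _)    zero    = r
    steps ((_ , r) ∷ (_ ∷ _)) zero    = r
    steps (_ ∷ ω)             (suc i) = steps ω i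
    inP : ∀ {x y} (ω : Walkᵀ x y) i → P (vertex ω i)
    inP ω       zero    = first ω
    inP (_ ∷ ω) (suc i) = inP ω i

  fromWalkIn : ∀ {x y} → WalkIn T P x y → Walkᵀ x y
  fromWalkIn ω = subst₂ Walkᵀ (WalkIn.start ω) (WalkIn.end ω)
                        (along (WalkIn.len ω) (WalkIn.vtx ω) (WalkIn.steps ω) (WalkIn.inP ω))
    where
    along : ∀ l (v : Fin (suc l) → Fin t) → (∀ (i : Fin l) → _~_ T (v (inject₁ i)) (v (suc i))) →
            (∀ i → P (v i)) → Walkᵀ (v zero) (v (fromℕ l))
    along zero    v steps inP = [] (inP zero)
    along (suc l) v steps inP = (inP zero , steps zero) ∷ along l (v ∘ suc) (steps ∘ suc) (inP ∘ suc)

cyc-cases : ∀ {k} (i : Fin (suc k)) → toℕ (cyc i) ≡ suc (toℕ i) ⊎ (toℕ i ≡ k × cyc i ≡ zero)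
cyc-cases {k} i with suc (toℕ i) <? suc k
... | yes i+1<k+1 = inj₁ (toℕ-fromℕ< i+1<k+1)
... | no  i+1≮k+1 = inj₂ (≤-antisym (≤-pred (toℕ<n i)) (≮⇒≥ (i+1≮k+1 ∘ s≤s)) , refl)

cyc-surjective : ∀ {k} (i : Fin (suc k)) → ∃[ h ] cyc h ≡ i
cyc-surjective {k} zero with cyc-cases (fromℕ k)
... | inj₁ overflow = ⊥-elim (<-irrefl (trans overflow (cong suc (toℕ-fromℕ k))) (toℕ<n (cyc (fromℕ k))))
... | inj₂ (_ , wrap) = fromℕ k , wrap
cyc-surjective {suc k} (suc j) with cyc-cases (inject₁ j)
... | inj₁ step      = inject₁ j , toℕ-injective (trans step (cong suc (toℕ-inject₁ j)))
... | inj₂ (last , _) = ⊥-elim (<-irrefl (trans (sym (toℕ-inject₁ j)) last) (toℕ<n j))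

cyc∘cyc≢id : ∀ {k} (i : Fin (suc (suc (suc k)))) → cyc (cyc i) ≢ i
cyc∘cyc≢id {k} i back with cyc-cases i | cyc-cases (cyc i)
... | inj₁ step₁ | inj₁ step₂ =
  m≢1+n+m (toℕ i) {1} (trans (sym (cong toℕ back)) (trans step₂ (cong suc step₁)))
... | inj₁ step₁ | inj₂ (last , wrap) =
  0≢1+n (suc-injective (trans (cong suc (sym i≡0)) (trans (sym step₁) last)))
  where
  i≡0 : toℕ i ≡ 0
  i≡0 = cong toℕ (trans (sym back) wrap)
... | inj₂ (last , wrap) | _ =
  0≢1+n (suc-injective (trans (sym cyc0≡1) (trans (cong (toℕ ∘ cyc) (sym wrap)) (trans (cong toℕ back) last))))
  where
  cyc0≡1 : toℕ (cyc (zero {suc (suc k)})) ≡ 1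
  cyc0≡1 = refl

argmax : ∀ {m} (f : Fin (suc m) → ℕ) → ∃[ i ] (∀ j → f j ≤ f i)
argmax {zero}  f = zero , λ { zero → ≤-refl }
argmax {suc m} f with argmax (f ∘ suc)
... | i , i-max with f zero ≤? f (suc i)
...   | yes f0≤ = suc i , λ { zero → f0≤       ; (suc j) → i-max j }
...   | no  f0≰ = zero  , λ { zero → ≤-refl    ; (suc j) → ≤-trans (i-max j) (<⇒≤ (≰⇒> f0≰)) }

greatest : ∀ {m} {P : Fin m → Set} → Decidable P → ∃[ x ] P x → ∃[ x ] (P x × ∀ y → P y → y ≤ᶠ x)
greatest {suc m} P? witness with Fin.any? (P? ∘ suc)
... | yes later with greatest (P? ∘ suc) later
...   | x , Px , x-max = suc x , Px , λ { zero _ → z≤n ; (suc y) Py → s≤s (x-max y Py) }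
greatest {suc m} P? (zero , P0)  | no none-later =
  zero , P0 , λ { zero _ → z≤n ; (suc y) Py → ⊥-elim (none-later (y , Py)) }
greatest {suc m} P? (suc x , Px) | no none-later = ⊥-elim (none-later (x , Px))

module BinaryTree (Bag : Set) where

  data BT : Set where
    leaf : Bag → BT
    node : Bag → BT → BT → BT

  data Pos : BT → Set where
    root  : ∀ {τ} → Pos τ
    left  : ∀ {B l r} → Pos l → Pos (node B l r)
    right : ∀ {B l r} → Pos r → Pos (node B l r)

  rootBag : BT → Bag
  rootBag (leaf B)     = B
  rootBag (node B _ _) = B

  bagAt : (τ : BT) → Pos τ → Bag
  bagAt τ            root      = rootBag τ
  bagAt (node _ l r) (left p)  = bagAt l p
  bagAt (node _ l r) (right p) = bagAt r p

  parent : ∀ {τ} → Pos τ → Maybe (Pos τ)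
  parent root      = nothing
  parent (left p)  = just (maybe left root (parent p))
  parent (right p) = just (maybe right root (parent p))

  depth : ∀ {τ} → Pos τ → ℕ
  depth root      = 0
  depth (left p)  = suc (depth p)
  depth (right p) = suc (depth p)

  depth-parent : ∀ {τ} (p : Pos τ) → depth p ≡ maybe (suc ∘ depth) 0 (parent p)
  depth-parent root      = refl
  depth-parent (left p)  = cong suc (trans (depth-parent p) (lift (parent p)))
    where
    lift : ∀ m → maybe (suc ∘ depth) 0 m ≡ depth (maybe left root m)
    lift nothing  = refl
    lift (just _) = refl
  depth-parent (right p) = cong suc (trans (depth-parent p) (lift (parent p)))
    where
    lift : ∀ m → maybe (suc ∘ depth) 0 m ≡ depth (maybe right root m)
    lift nothing  = refl
    lift (just _) = refl

  parent-deeper : ∀ {τ} {p q : Pos τ} → parent p ≡ just q → depth p ≡ suc (depth q)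
  parent-deeper {p = p} eq = trans (depth-parent p) (cong (maybe (suc ∘ depth) 0) eq)

  _—_ : ∀ {τ} → Pos τ → Pos τ → Set
  p — q = parent p ≡ just q ⊎ parent q ≡ just p

  —-sym : ∀ {τ} {p q : Pos τ} → p — q → q — p
  —-sym (inj₁ e) = inj₂ e
  —-sym (inj₂ e) = inj₁ e

  —-shallower : ∀ {τ} {p q : Pos τ} → p — q → depth q ≤ depth p → parent p ≡ just q
  —-shallower (inj₁ e) _ = e
  —-shallower (inj₂ e) q≤p = ⊥-elim (1+n≰n (subst (_≤ _) (parent-deeper e) q≤p))

  has-parent : ∀ {τ} (p : Pos τ) → p ≢ root → ∃[ q ] parent p ≡ just q
  has-parent root      p≢root = ⊥-elim (p≢root refl)
  has-parent (left p)  _      = _ , refl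
  has-parent (right p) _      = _ , refl

  _≟ₚ_ : ∀ {τ} (p q : Pos τ) → Dec (p ≡ q)
  root    ≟ₚ root    = yes refl
  left p  ≟ₚ left q  with p ≟ₚ q
  ... | yes refl = yes refl
  ... | no  p≢q  = no λ { refl → p≢q refl }
  right p ≟ₚ right q with p ≟ₚ q
  ... | yes refl = yes refl
  ... | no  p≢q  = no λ { refl → p≢q refl }
  root    ≟ₚ left _  = no λ ()
  root    ≟ₚ right _ = no λ ()
  left _  ≟ₚ root    = no λ ()
  left _  ≟ₚ right _ = no λ ()
  right _ ≟ₚ root    = no λ ()
  right _ ≟ₚ left _  = no λ ()

  -- A summit of a set Q of positions: a member 'top' such that every other member
  -- has its parent in Q.  A set with a summit is connected in the tree.
  record Summit {τ} (Q : Pos τ → Set) : Set where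
    field
      top   : Pos τ
      top∈  : Q top
      climb : ∀ p → Q p → p ≢ top → ∃[ p′ ] (parent p ≡ just p′ × Q p′)

  summit-linked : ∀ {τ} {Q : Pos τ → Set} → Summit Q → Linked _—_ Q
  summit-linked {Q = Q} σ p q Qp Qq = ascend _ p ≤-refl Qp ++ reverse —-sym (ascend _ q ≤-refl Qq)
    where
    open Summit σ
    -- climbing from p to the top, using the depth of p as fuel
    ascend : ∀ d p → depth p ≤ d → Q p → Walk _—_ Q p top
    ascend d p p≤d Qp with p ≟ₚ top
    ... | yes refl = [] Qp
    ... | no p≢top with climb p Qp p≢top
    ...   | p′ , up , Qp′ with d | ≤-trans (≤-reflexive (sym (parent-deeper up))) p≤d
    ...     | suc d′ | s≤s p′≤d′ = (Qp , inj₁ up) ∷ ascend d′ p′ p′≤d′ Qp′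

  leaf-summit : ∀ {B} {Q : Pos (leaf B) → Set} → Q root → Summit Q
  leaf-summit Qroot = record { top = root ; top∈ = Qroot ; climb = λ { root _ root≢root → ⊥-elim (root≢root refl) } }

  summit-at-root : ∀ {B l r} {Q : Pos (node B l r) → Set} → Q root →
                   (∀ {p p′} → parent p ≡ just p′ → Q (left p) → Q (left p′)) →
                   (∀ {p p′} → parent p ≡ just p′ → Q (right p) → Q (right p′)) → Summit Q
  summit-at-root {Q = Q} Qroot left-closed right-closed = record { top = root ; top∈ = Qroot ; climb = climb }
    where
    climb : ∀ p → Q p → p ≢ root → ∃[ p′ ] (parent p ≡ just p′ × Q p′)
    climb root _ root≢root = ⊥-elim (root≢root refl)
    climb (left p) Qp _ with parent p in up
    ... | nothing = root , refl , Qroot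
    ... | just p′ = left p′ , refl , left-closed up Qp
    climb (right p) Qp _ with parent p in up
    ... | nothing = root , refl , Qroot
    ... | just p′ = right p′ , refl , right-closed up Qp

  summit-left : ∀ {B l r} {Q : Pos (node B l r) → Set} → ¬ Q root → (∀ p → ¬ Q (right p)) →
                Summit (Q ∘ left) → Summit Q
  summit-left {Q = Q} ¬Qroot ¬Qright σ = record { top = left top ; top∈ = top∈ ; climb = climbᴸ }
    where
    open Summit σ
    climbᴸ : ∀ p → Q p → p ≢ left top → ∃[ p′ ] (parent p ≡ just p′ × Q p′)
    climbᴸ root      Qp _ = ⊥-elim (¬Qroot Qp)
    climbᴸ (right p) Qp _ = ⊥-elim (¬Qright p Qp)
    climbᴸ (left p)  Qp p≢top with climb p Qp (λ { refl → p≢top refl })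
    ... | p′ , up , Qp′ = left p′ , cong (just ∘ maybe left root) up , Qp′

  summit-right : ∀ {B l r} {Q : Pos (node B l r) → Set} → ¬ Q root → (∀ p → ¬ Q (left p)) →
                 Summit (Q ∘ right) → Summit Q
  summit-right {Q = Q} ¬Qroot ¬Qleft σ = record { top = right top ; top∈ = top∈ ; climb = climbᴿ }
    where
    open Summit σ
    climbᴿ : ∀ p → Q p → p ≢ right top → ∃[ p′ ] (parent p ≡ just p′ × Q p′)
    climbᴿ root      Qp _ = ⊥-elim (¬Qroot Qp)
    climbᴿ (left p)  Qp _ = ⊥-elim (¬Qleft p Qp)
    climbᴿ (right p) Qp p≢top with climb p Qp (λ { refl → p≢top refl })
    ... | p′ , up , Qp′ = right p′ , cong (just ∘ maybe right root) up , Qp′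

  size : BT → ℕ
  size (leaf _)     = 1
  size (node _ l r) = suc (size l + size r)

  encode : ∀ {τ} → Pos τ → Fin (size τ)
  encode {leaf _}     root      = zero
  encode {node _ l r} root      = zero
  encode {node _ l r} (left p)  = suc (encode p ↑ˡ size r)
  encode {node _ l r} (right p) = suc (size l ↑ʳ encode p)

  decode : ∀ τ → Fin (size τ) → Pos τ
  decode (leaf _)     _       = root
  decode (node _ l r) zero    = root
  decode (node _ l r) (suc i) = [ left ∘ decode l , right ∘ decode r ]′ (splitAt (size l) i)

  decode-encode : ∀ {τ} (p : Pos τ) → decode τ (encode p) ≡ p
  decode-encode {leaf _}     root      = refl
  decode-encode {node _ l r} root      = refl
  decode-encode {node _ l r} (left p)  rewrite splitAt-↑ˡ (size l) (encode p) (size r) = cong left (decode-encode p)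
  decode-encode {node _ l r} (right p) rewrite splitAt-↑ʳ (size l) (size r) (encode p) = cong right (decode-encode p)

  encode-decode : ∀ τ (i : Fin (size τ)) → encode (decode τ i) ≡ i
  encode-decode (leaf _)     zero    = refl
  encode-decode (node _ l r) zero    = refl
  encode-decode (node _ l r) (suc i) with splitAt (size l) i in split
  ... | inj₁ j = cong suc (trans (cong (_↑ˡ size r) (encode-decode l j)) (rejoin split))
    where
    rejoin : ∀ {s} → splitAt (size l) i ≡ s → join (size l) (size r) s ≡ i
    rejoin refl = join-splitAt (size l) (size r) i
  ... | inj₂ j = cong suc (trans (cong (size l ↑ʳ_) (encode-decode r j)) (rejoin split))
    where
    rejoin : ∀ {s} → splitAt (size l) i ≡ s → join (size l) (size r) s ≡ i
    rejoin refl = join-splitAt (size l) (size r) i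

  decode-injective : ∀ τ {i j} → decode τ i ≡ decode τ j → i ≡ j
  decode-injective τ {i} {j} e = trans (sym (encode-decode τ i)) (trans (cong encode e) (encode-decode τ j))

  treeGraph : (τ : BT) → Graph (size τ)
  treeGraph τ = record { _~_ = λ x y → decode τ x — decode τ y ; ~-sym = —-sym ; ~-irr = irreflexive }
    where
    irreflexive : ∀ {x} → ¬ (decode τ x — decode τ x)
    irreflexive (inj₁ e) = <-irrefl (parent-deeper e) (≤-refl {suc _})
    irreflexive (inj₂ e) = <-irrefl (parent-deeper e) (≤-refl {suc _})

  linked-numbered : ∀ τ {Q : Pos τ → Set} → Linked _—_ Q → Linked (_~_ (treeGraph τ)) (Q ∘ decode τ)
  linked-numbered τ {Q} linked x y Qx Qy =
    subst₂ (Walk (_~_ (treeGraph τ)) (Q ∘ decode τ)) (encode-decode τ x) (encode-decode τ y)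
      (mapWalk encode (subst₂ _—_ (sym (decode-encode _)) (sym (decode-encode _)))
                      (subst Q (sym (decode-encode _)))
                      (linked _ _ Qx Qy))

  treeGraph-isTree : ∀ τ → IsTree (treeGraph τ)
  treeGraph-isTree τ = record { nonempty = nonempty τ ; connected = everything-connected ; acyclic = no-cycle }
    where
    nonempty : ∀ τ → 0 < size τ
    nonempty (leaf _)     = s≤s z≤n
    nonempty (node _ _ _) = s≤s z≤n

    everything-connected : ConnectedSet (treeGraph τ) (λ _ → ⊤)
    everything-connected x y _ _ = toWalkIn (treeGraph τ) (linked-numbered τ (summit-linked everything) x y tt tt)
      where
      everything : Summit (λ _ → ⊤)
      everything = record { top = root ; top∈ = tt ; climb = λ p _ p≢root → map₂ (_, tt) (has-parent p p≢root) }

    -- the deepest vertex of a cycle would have both of its cycle neighbours as parent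
    no-cycle : ¬ CycleIn (treeGraph τ)
    no-cycle C with argmax (depth ∘ decode τ ∘ CycleIn.vtx C)
    ... | i , deepest with cyc-surjective i
    ...   | h , h→i = cyc∘cyc≢id i (trans (cong cyc next≡prev) h→i)
      where
      open CycleIn C
      pos : Fin _ → Pos τ
      pos = decode τ ∘ vtx
      parent-is-next : parent (pos i) ≡ just (pos (cyc i))
      parent-is-next = —-shallower (adj i) (deepest (cyc i))
      parent-is-prev : parent (pos i) ≡ just (pos h)
      parent-is-prev = —-shallower (subst (λ j → pos j — pos h) h→i (—-sym (adj h))) (deepest h)
      next≡prev : cyc i ≡ h
      next≡prev = inj (decode-injective τ (just-injective (trans (sym parent-is-next) parent-is-prev)))

maxOver-ub : ∀ {t} (f : Fin t → ℕ) i → f i ≤ maxOver f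
maxOver-ub f zero    = m≤m⊔n _ _
maxOver-ub f (suc i) = ≤-trans (maxOver-ub (f ∘ suc) i) (m≤n⊔m _ _)

maxOver-lub : ∀ {t} (f : Fin t → ℕ) {B} → (∀ i → f i ≤ B) → maxOver f ≤ B
maxOver-lub {zero}  f bound = z≤n
maxOver-lub {suc t} f bound = ⊔-lub (bound zero) (maxOver-lub (f ∘ suc) (bound ∘ suc))

bag-size≤ : ∀ {N t} {G : Multigraph N} {T : Graph t} (D : TreeDecomposition G T) {w} →
            width D ≡ w → ∀ x → ∣ bag D x ∣ ≤ w + 1
bag-size≤ D {w} refl x =
  ≤-trans (maxOver-ub _ x) (≤-trans (m≤n+m∸n _ 1) (≤-reflexive (+-comm 1 (width D))))

width≤ : ∀ {N t} {G : Multigraph N} {T : Graph t} (D : TreeDecomposition G T) {B} →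
         (∀ x → ∣ bag D x ∣ ≤ B) → width D ≤ B ∸ 1
width≤ D small = ∸-monoˡ-≤ 1 (maxOver-lub _ small)

record Decomposition {n t} (T : Graph t) (R : Fin n → Fin n → Set) : Set where
  field
    piece         : Fin t → Subset n
    covers-vertex : ∀ u → ∃[ x ] u ∈ piece x
    covers-pair   : ∀ {u v} → R u v → ∃[ x ] (u ∈ piece x × v ∈ piece x)
    pieces-linked : ∀ u → Linked (_~_ T) (λ x → u ∈ piece x)

module Substitution
  {N n t} {soc : Society N n} {H : Multigraph n} {T : Graph t} {R : Fin n → Fin n → Set}
  (T-tree : IsTree T) (Δ : Decomposition T R)
  (consecutive-related : ∀ {i j} → _~_ (PathGraph n) i j → R i j)
  (edges-related : ∀ e → R (proj₁ (ends H e)) (proj₂ (ends H e)))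
  (D : VorticalDecomposition soc) where

  open Decomposition Δ

  X : Fin n → Subset N
  X = bag (pd D)

  substituted-bag : Fin t → Subset N
  substituted-bag x = ⋃[ piece x ] X

  ∈substituted : ∀ {v} x u → u ∈ piece x → v ∈ X u → v ∈ substituted-bag x
  ∈substituted x = ∈⋃⁺ (piece x) X

  lift-walk : ∀ v {u u′} → Walk (_~_ (PathGraph n)) (λ i → v ∈ X i) u u′ → ∀ x → u ∈ piece x →
              ∃[ y ] (u′ ∈ piece y × Walk (_~_ T) (λ z → v ∈ substituted-bag z) x y)
  lift-walk v ([] v∈Xu) x u∈x = x , u∈x , [] (∈substituted x _ u∈x v∈Xu)
  lift-walk v ((v∈Xu , u~j) ∷ rest) x u∈x with covers-pair (consecutive-related u~j)
  ... | y , u∈y , j∈y with lift-walk v rest y j∈y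
  ...   | z , u′∈z , ω =
    z , u′∈z , (weaken (λ {s} u∈s → ∈substituted s _ u∈s v∈Xu) (pieces-linked _ x y u∈x u∈y) ++ ω)

  substituted-linked : ∀ v → Linked (_~_ T) (λ x → v ∈ substituted-bag x)
  substituted-linked v x y v∈x v∈y with ∈⋃⁻ (piece x) X v∈x | ∈⋃⁻ (piece y) X v∈y
  ... | u , u∈x , v∈Xu | u′ , u′∈y , v∈Xu′
    with lift-walk v (fromWalkIn (PathGraph n) (connected (pd D) v u u′ v∈Xu v∈Xu′)) x u∈x
  ...   | z , u′∈z , ω =
    ω ++ weaken (λ {s} u′∈s → ∈substituted s u′ u′∈s v∈Xu′) (pieces-linked u′ z y u′∈z u′∈y)

  substituted-covers-vertex : ∀ v → ∃[ x ] v ∈ substituted-bag x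
  substituted-covers-vertex v with coverV (pd D) v
  ... | u , v∈Xu with covers-vertex u
  ...   | x , u∈x = x , ∈substituted x u u∈x v∈Xu

  -- edges of S lie in a bag X_u; an edge of H joining a, b becomes Ω a Ω b, and Ω i ∈ X_i
  substituted-covers-edge : ∀ e → ∃[ x ] (proj₁ (ends (glue soc H) e) ∈ substituted-bag x ×
                                          proj₂ (ends (glue soc H) e) ∈ substituted-bag x)
  substituted-covers-edge e with splitAt (m (S soc)) e
  ... | inj₁ e′ with coverE (pd D) e′
  ...   | u , end₁∈Xu , end₂∈Xu with covers-vertex u
  ...     | x , u∈x = x , ∈substituted x u u∈x end₁∈Xu , ∈substituted x u u∈x end₂∈Xu
  substituted-covers-edge e | inj₂ e′ with covers-pair (edges-related e′)
  ... | x , a∈x , b∈x = x , ∈substituted x _ a∈x (boundary D _) , ∈substituted x _ b∈x (boundary D _)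

  substituted : TreeDecomposition (glue soc H) T
  substituted = record
    { isTree    = T-tree
    ; bag       = substituted-bag
    ; coverV    = substituted-covers-vertex
    ; coverE    = substituted-covers-edge
    ; connected = λ v x y v∈x v∈y → toWalkIn T (substituted-linked v x y v∈x v∈y)
    }

  substituted-width : ∀ {q w} → (∀ x → ∣ piece x ∣ ≤ q) → width (pd D) ≡ w →
                      width substituted ≤ q * (w + 1) ∸ 1
  substituted-width {q} {w} small width≡w = width≤ substituted λ x →
    ≤-trans (∣⋃∣≤ (piece x) X (bag-size≤ (pd D) width≡w)) (*-monoˡ-≤ (w + 1) (small x))

module Necklace {q k : ℕ} {H : Multigraph (suc k)} (necklace : IsNecklace q H) (3≤q : 3 ≤ q) where

  open IsNecklace necklace
  open BinaryTree (Subset (suc k))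

  Vtx : Set
  Vtx = Fin (suc k)

  Mates : Vtx → Vtx → Set
  Mates x y = ∃[ j ] (x ∈ V (M j) × y ∈ V (M j))

  Consecutive : Vtx → Vtx → Set
  Consecutive x y = cyc x ≡ y ⊎ cyc y ≡ x

  -- adjacency in H (every edge of H lies on C or in a clique)
  Adj : Vtx → Vtx → Set
  Adj x y = Mates x y ⊎ Consecutive x y

  Adj-sym : ∀ {x y} → Adj x y → Adj y x
  Adj-sym (inj₁ (j , x∈ , y∈)) = inj₁ (j , y∈ , x∈)
  Adj-sym (inj₂ (inj₁ e))      = inj₂ (inj₂ e)
  Adj-sym (inj₂ (inj₂ e))      = inj₂ (inj₁ e)

  Adj? : ∀ x y → Dec (Adj x y)
  Adj? x y = Fin.any? (λ j → (x ∈? V (M j)) ×-dec (y ∈? V (M j))) ⊎-dec ((cyc x Fin.≟ y) ⊎-dec (cyc y Fin.≟ x))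

  edge-adjacent : ∀ e → Adj (proj₁ (ends H e)) (proj₂ (ends H e))
  edge-adjacent e with Fin.any? (λ j → cycleE j Fin.≟ e)
  ... | yes (j , refl) with cycle-joins j
  ...   | inj₁ ends≡ rewrite ends≡ = inj₂ (inj₁ refl)
  ...   | inj₂ ends≡ rewrite ends≡ = inj₂ (inj₂ refl)
  edge-adjacent e | no off-cycle with Equivalence.to (M-union e) off-cycle
  ... | i , e∈Mi with E-in (M i) e e∈Mi
  ...   | a , b , _ , a∈ , b∈ , inj₁ ends≡ rewrite ends≡ = inj₁ (i , a∈ , b∈)
  ...   | a , b , _ , a∈ , b∈ , inj₂ ends≡ rewrite ends≡ = inj₁ (i , b∈ , a∈)

  step-adjacent : ∀ {i j : Vtx} → toℕ j ≡ suc (toℕ i) → Adj i j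
  step-adjacent {i} {j} j≡i+1 with cyc-cases i
  ... | inj₁ step       = inj₂ (inj₁ (toℕ-injective (trans step (sym j≡i+1))))
  ... | inj₂ (last , _) = ⊥-elim (<-irrefl (trans j≡i+1 (cong suc last)) (toℕ<n j))

  interleaved-equal : ∀ {a b c d : Vtx} {i j} → a <ᶠ b → b <ᶠ c → c <ᶠ d →
                      a ∈ V (M i) → c ∈ V (M i) → b ∈ V (M j) → d ∈ V (M j) → i ≡ j
  interleaved-equal {a} {b} {c} {d} {i} {j} a<b b<c c<d a∈ c∈ b∈ d∈ with i Fin.≟ j
  ... | yes i≡j = i≡j
  ... | no  i≢j = ⊥-elim (noncrossing i j i≢j a b c d a<b b<c c<d (a∈ , c∈ , b∈ , d∈))

  jump-is-clique : ∀ {x m y : Vtx} → Adj x y → x <ᶠ m → m <ᶠ y → ¬ (x ≡ zero × toℕ y ≡ k) → Mates x y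
  jump-is-clique (inj₁ mates) _ _ _ = mates
  jump-is-clique {x} {m} {y} (inj₂ (inj₁ x→y)) x<m m<y _ with cyc-cases x
  ... | inj₁ step     = ⊥-elim (<-irrefl refl (≤-trans (s≤s x<m) (≤-trans m<y (≤-reflexive y≡x+1))))
    where
    y≡x+1 : toℕ y ≡ suc (toℕ x)
    y≡x+1 = trans (cong toℕ (sym x→y)) step
  ... | inj₂ (_ , wrap) = ⊥-elim (n≮0 (subst (toℕ m <_) (cong toℕ (trans (sym x→y) wrap)) m<y))
  jump-is-clique {x} {m} {y} (inj₂ (inj₂ y→x)) x<m m<y not-closing with cyc-cases y
  ... | inj₁ step          = ⊥-elim (<-asym (<-trans x<m m<y) (≤-reflexive (trans (sym step) (cong toℕ y→x))))
  ... | inj₂ (last , wrap) = ⊥-elim (not-closing (trans (sym y→x) wrap , last))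

  Between : Vtx → Vtx → Vtx → Set
  Between a b y = a ≤ᶠ y × y ≤ᶠ b

  Spanned : Vtx → Vtx → Vtx → Set
  Spanned a b v = a <ᶠ v × v <ᶠ b × ∃[ j ] (a ∈ V (M j) × b ∈ V (M j) × v ∈ V (M j))

  Spanned? : ∀ a b → Decidable (Spanned a b)
  Spanned? a b v = (a Fin.<? v) ×-dec (v Fin.<? b) ×-dec
                   Fin.any? (λ j → (a ∈? V (M j)) ×-dec ((b ∈? V (M j)) ×-dec (v ∈? V (M j))))

  record Interval (a b : Vtx) : Set where
    field
      tree         : BT
      within       : ∀ p {u} → u ∈ bagAt tree p → Between a b u
      a∈root       : a ∈ rootBag tree
      b∈root       : b ∈ rootBag tree
      spanned∈root : ∀ {v} → Spanned a b v → v ∈ rootBag tree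
      covers       : ∀ {y z} → Between a b y → Between a b z → Adj y z →
                     ∃[ p ] (y ∈ bagAt tree p × z ∈ bagAt tree p)
      small        : ∀ p → ∣ bagAt tree p ∣ ≤ q
      summit       : ∀ u {p} → u ∈ bagAt tree p → Summit (λ p → u ∈ bagAt tree p)

  root-member-climbs : ∀ {a b} (I : Interval a b) {u} → u ∈ rootBag (Interval.tree I) →
                       ∀ {p p′} → parent p ≡ just p′ →
                       u ∈ bagAt (Interval.tree I) p → u ∈ bagAt (Interval.tree I) p′
  root-member-climbs I {u} u∈root {p} up u∈p with Interval.summit I u {root} u∈root
  ... | σ with root ≟ₚ Summit.top σ
  ...   | no root≢top with Summit.climb σ root u∈root root≢top
  ...     | _ , () , _
  root-member-climbs I {u} u∈root {p} up u∈p | σ | yes root≡top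
    with Summit.climb σ p u∈p (λ p≡top → p-not-root (trans p≡top (sym root≡top)))
    where
    p-not-root : p ≢ root
    p-not-root p≡root with trans (cong parent (sym p≡root)) up
    ... | ()
  ... | p″ , up′ , u∈p″ = subst _ (just-injective (trans (sym up′) up)) u∈p″

  unit-interval : ∀ a b → toℕ b ≡ suc (toℕ a) → Interval a b
  unit-interval a b b≡a+1 = record
    { tree         = leaf pair
    ; within       = λ { root u∈ → between (∈⟦⟧⁻ pair? u∈) }
    ; a∈root       = ∈⟦⟧⁺ pair? (inj₁ refl)
    ; b∈root       = ∈⟦⟧⁺ pair? (inj₂ refl)
    ; spanned∈root = λ (a<v , v<b , _) → ⊥-elim (<-irrefl refl (≤-trans (s≤s a<v) (≤-trans v<b (≤-reflexive b≡a+1))))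
    ; covers       = λ y∈ z∈ _ → root , ∈⟦⟧⁺ pair? (endpoint y∈) , ∈⟦⟧⁺ pair? (endpoint z∈)
    ; small        = λ { root → ≤-trans (∣⊆abc∣≤3 a b b pair (λ u∈ → [ inj₁ , inj₂ ∘ inj₁ ]′ (∈⟦⟧⁻ pair? u∈))) 3≤q }
    ; summit       = λ { u {root} u∈ → leaf-summit u∈ }
    }
    where
    pair? : Decidable (λ v → v ≡ a ⊎ v ≡ b)
    pair? v = (v Fin.≟ a) ⊎-dec (v Fin.≟ b)
    pair : Subset (suc k)
    pair = ⟦ pair? ⟧
    between : ∀ {u} → u ≡ a ⊎ u ≡ b → Between a b u
    between (inj₁ refl) = ≤-refl , ≤-trans (n≤1+n _) (≤-reflexive (sym b≡a+1))
    between (inj₂ refl) = ≤-trans (n≤1+n _) (≤-reflexive (sym b≡a+1)) , ≤-refl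
    endpoint : ∀ {y} → Between a b y → y ≡ a ⊎ y ≡ b
    endpoint (a≤y , y≤b) with m≤n⇒m<n∨m≡n a≤y
    ... | inj₂ a≡y = inj₁ (toℕ-injective (sym a≡y))
    ... | inj₁ a<y = inj₂ (toℕ-injective (≤-antisym y≤b (≤-trans (≤-reflexive b≡a+1) a<y)))

  module Join {a b c : Vtx} (a<c : a <ᶠ c) (c<b : c <ᶠ b) (a~c : Adj a c)
              (c-last : ∀ {y} → a <ᶠ y → y <ᶠ b → Adj a y → y ≤ᶠ c)
              (L : Interval a c) (R : Interval c b) where

    module L = Interval L
    module R = Interval R

    RootMember : Vtx → Set
    RootMember v = v ≡ a ⊎ v ≡ b ⊎ v ≡ c ⊎ Spanned a b v

    RootMember? : Decidable RootMember
    RootMember? v = (v Fin.≟ a) ⊎-dec (v Fin.≟ b) ⊎-dec (v Fin.≟ c) ⊎-dec Spanned? a b v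

    joinBag : Subset (suc k)
    joinBag = ⟦ RootMember? ⟧

    joined-tree : BT
    joined-tree = node joinBag L.tree R.tree

    a∈joinBag : a ∈ joinBag
    a∈joinBag = ∈⟦⟧⁺ RootMember? (inj₁ refl)

    b∈joinBag : b ∈ joinBag
    b∈joinBag = ∈⟦⟧⁺ RootMember? (inj₂ (inj₁ refl))

    c∈joinBag : c ∈ joinBag
    c∈joinBag = ∈⟦⟧⁺ RootMember? (inj₂ (inj₂ (inj₁ refl)))

    -- c < b ≤ k, so the adjacency a c is never the closing edge of the cycle
    c≢last : toℕ c ≢ k
    c≢last c≡k = <-irrefl refl (≤-trans c<b (≤-trans (≤-pred (toℕ<n b)) (≤-reflexive (sym c≡k))))

    beyond-c : ∀ {z} → c <ᶠ z → z ≤ᶠ b → Adj a z → z ≡ b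
    beyond-c c<z z≤b a~z with m≤n⇒m<n∨m≡n z≤b
    ... | inj₂ z≡b = toℕ-injective z≡b
    ... | inj₁ z<b = ⊥-elim (<-irrefl refl (≤-trans c<z (c-last (<-trans a<c c<z) z<b a~z)))

    c∈clique : ∀ {j y} → a <ᶠ y → y <ᶠ b → a ∈ V (M j) → b ∈ V (M j) → y ∈ V (M j) → c ∈ V (M j)
    c∈clique {j} {y} a<y y<b a∈ b∈ y∈ with m≤n⇒m<n∨m≡n (c-last a<y y<b (inj₁ (j , a∈ , y∈)))
    ... | inj₂ y≡c = subst (_∈ V (M j)) (toℕ-injective y≡c) y∈
    ... | inj₁ y<c with jump-is-clique a~c a<y y<c (λ (_ , c≡k) → c≢last c≡k)
    ...   | i , a∈i , c∈i = subst (λ j → c ∈ V (M j)) (interleaved-equal a<y y<c c<b a∈i c∈i y∈ b∈) c∈i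

    within : ∀ p {u} → u ∈ bagAt joined-tree p → Between a b u
    within root u∈ with ∈⟦⟧⁻ RootMember? u∈
    ... | inj₁ refl                          = ≤-refl , <⇒≤ (<-trans a<c c<b)
    ... | inj₂ (inj₁ refl)                   = <⇒≤ (<-trans a<c c<b) , ≤-refl
    ... | inj₂ (inj₂ (inj₁ refl))            = <⇒≤ a<c , <⇒≤ c<b
    ... | inj₂ (inj₂ (inj₂ (a<u , u<b , _))) = <⇒≤ a<u , <⇒≤ u<b
    within (left p) u∈  with L.within p u∈
    ... | a≤u , u≤c = a≤u , ≤-trans u≤c (<⇒≤ c<b)
    within (right p) u∈ with R.within p u∈
    ... | c≤u , u≤b = ≤-trans (<⇒≤ a<c) c≤u , u≤b

    root-to-left : ∀ {u} → u ∈ joinBag → u ≤ᶠ c → u ∈ rootBag L.tree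
    root-to-left u∈ u≤c with ∈⟦⟧⁻ RootMember? u∈
    ... | inj₁ refl               = L.a∈root
    ... | inj₂ (inj₁ refl)        = ⊥-elim (<-irrefl refl (≤-trans c<b u≤c))
    ... | inj₂ (inj₂ (inj₁ refl)) = L.b∈root
    ... | inj₂ (inj₂ (inj₂ (a<u , u<b , j , a∈ , b∈ , u∈j))) with m≤n⇒m<n∨m≡n u≤c
    ...   | inj₂ u≡c = subst (_∈ rootBag L.tree) (sym (toℕ-injective u≡c)) L.b∈root
    ...   | inj₁ u<c = L.spanned∈root (a<u , u<c , j , a∈ , c∈clique a<u u<b a∈ b∈ u∈j , u∈j)

    -- … and the part from c on lies in the root bag of R (it is just b and c)
    root-to-right : ∀ {u} → u ∈ joinBag → c ≤ᶠ u → u ∈ rootBag R.tree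
    root-to-right u∈ c≤u with ∈⟦⟧⁻ RootMember? u∈
    ... | inj₁ refl               = ⊥-elim (<-irrefl refl (≤-trans a<c c≤u))
    ... | inj₂ (inj₁ refl)        = R.b∈root
    ... | inj₂ (inj₂ (inj₁ refl)) = R.a∈root
    ... | inj₂ (inj₂ (inj₂ (a<u , u<b , j , a∈ , _ , u∈j))) with m≤n⇒m<n∨m≡n c≤u
    ...   | inj₂ c≡u = subst (_∈ rootBag R.tree) (toℕ-injective c≡u) R.a∈root
    ...   | inj₁ c<u = ⊥-elim (<-irrefl refl (≤-trans c<u (c-last a<u u<b (inj₁ (j , a∈ , u∈j)))))

    -- only c occurs in both subtrees, and c is in the root bag
    both-sides : ∀ {u} p p′ → u ∈ bagAt L.tree p → u ∈ bagAt R.tree p′ → u ∈ joinBag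
    both-sides p p′ u∈L u∈R =
      subst (_∈ joinBag) (Fin.≤-antisym (proj₁ (R.within p′ u∈R)) (proj₂ (L.within p u∈L))) c∈joinBag

    -- members of the new root bag climb into it from both subtrees; any other
    -- vertex occurs on one side only and keeps the summit it has there
    joined-summit : ∀ u {p} → u ∈ bagAt joined-tree p → Summit (λ p → u ∈ bagAt joined-tree p)
    joined-summit u {p} u∈p with u ∈? joinBag | p
    ... | yes u∈root | _ = summit-at-root u∈root
      (λ {p} up u∈ → root-member-climbs L (root-to-left u∈root (proj₂ (L.within p u∈))) up u∈)
      (λ {p} up u∈ → root-member-climbs R (root-to-right u∈root (proj₁ (R.within p u∈))) up u∈)
    ... | no u∉root | root     = ⊥-elim (u∉root u∈p)
    ... | no u∉root | left p₀  =
      summit-left u∉root (λ p′ u∈R → u∉root (both-sides p₀ p′ u∈p u∈R)) (L.summit u {p₀} u∈p)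
    ... | no u∉root | right p₀ =
      summit-right u∉root (λ p′ u∈L → u∉root (both-sides p′ p₀ u∈L u∈p)) (R.summit u {p₀} u∈p)

    -- an adjacency y z straddling c joins two vertices of the new root bag:
    -- either y = a and z = b, or y, a, c, z share a clique, which forces z = b
    -- and makes y spanned by a and b
    straddling : ∀ {y z} → Between a b y → Between a b z → y <ᶠ c → c <ᶠ z → Adj y z →
                 y ∈ joinBag × z ∈ joinBag
    straddling {y} {z} (a≤y , _) (_ , z≤b) y<c c<z y~z with m≤n⇒m<n∨m≡n a≤y
    ... | inj₂ a≡y =
      subst (_∈ joinBag) (toℕ-injective a≡y) a∈joinBag ,
      subst (_∈ joinBag) (sym (beyond-c c<z z≤b (subst (λ x → Adj x z) (toℕ-injective (sym a≡y)) y~z))) b∈joinBag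
    ... | inj₁ a<y with jump-is-clique y~z y<c c<z (λ (y≡0 , _) → n≮0 (subst (toℕ a <_) (cong toℕ y≡0) a<y))
                      | jump-is-clique a~c a<y y<c (λ (_ , c≡k) → c≢last c≡k)
    ...   | j , y∈j , z∈j | i , a∈i , c∈i with interleaved-equal a<y y<c c<z a∈i c∈i y∈j z∈j
    ...     | refl with beyond-c c<z z≤b (inj₁ (i , a∈i , z∈j))
    ...       | refl = ∈⟦⟧⁺ RootMember? (inj₂ (inj₂ (inj₂ (a<y , <-trans y<c c<b , i , a∈i , z∈j , y∈j)))) , b∈joinBag

    covers-ordered : ∀ {y z} → Between a b y → Between a b z → y ≤ᶠ z → Adj y z →
                     ∃[ p ] (y ∈ bagAt joined-tree p × z ∈ bagAt joined-tree p)
    covers-ordered {y} {z} (a≤y , y≤b) (a≤z , z≤b) y≤z y~z with z Fin.≤? c | c Fin.≤? y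
    ... | yes z≤c | _ with L.covers (a≤y , ≤-trans y≤z z≤c) (a≤z , z≤c) y~z
    ...   | p , y∈ , z∈ = left p , y∈ , z∈
    covers-ordered {y} {z} (a≤y , y≤b) (a≤z , z≤b) y≤z y~z | no _ | yes c≤y
      with R.covers (c≤y , y≤b) (≤-trans c≤y y≤z , z≤b) y~z
    ... | p , y∈ , z∈ = right p , y∈ , z∈
    covers-ordered y∈ z∈ _ y~z | no z≰c | no c≰y = root , straddling y∈ z∈ (≰⇒> c≰y) (≰⇒> z≰c) y~z

    joined-covers : ∀ {y z} → Between a b y → Between a b z → Adj y z →
                    ∃[ p ] (y ∈ bagAt joined-tree p × z ∈ bagAt joined-tree p)
    joined-covers {y} {z} y∈ z∈ y~z with Fin.≤-total y z
    ... | inj₁ y≤z = covers-ordered y∈ z∈ y≤z y~z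
    ... | inj₂ z≤y with covers-ordered z∈ y∈ z≤y (Adj-sym y~z)
    ...   | p , z∈p , y∈p = p , y∈p , z∈p

    root⊆clique : ∀ {y₀ j₀} → a <ᶠ y₀ → y₀ <ᶠ b → a ∈ V (M j₀) → b ∈ V (M j₀) → y₀ ∈ V (M j₀) →
                  joinBag ⊆ V (M j₀)
    root⊆clique {y₀} {j₀} a<y₀ y₀<b a∈j₀ b∈j₀ y₀∈j₀ u∈ with ∈⟦⟧⁻ RootMember? u∈
    ... | inj₁ refl               = a∈j₀
    ... | inj₂ (inj₁ refl)        = b∈j₀
    ... | inj₂ (inj₂ (inj₁ refl)) = c∈clique a<y₀ y₀<b a∈j₀ b∈j₀ y₀∈j₀
    ... | inj₂ (inj₂ (inj₂ (a<u , u<b , j , a∈j , b∈j , u∈j))) with Fin.<-cmp _ y₀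
    ...   | tri< u<y₀ _ _ = subst (λ i → _ ∈ V (M i)) (sym (interleaved-equal a<u u<y₀ y₀<b a∈j₀ y₀∈j₀ u∈j b∈j)) u∈j
    ...   | tri≈ _ refl _ = y₀∈j₀
    ...   | tri> _ _ y₀<u = subst (λ i → _ ∈ V (M i)) (interleaved-equal a<y₀ y₀<u u<b a∈j u∈j y₀∈j₀ b∈j₀) u∈j

    -- the root bag has at most q vertices: it lies in one clique, or it is {a, b, c}
    small-root : ∣ joinBag ∣ ≤ q
    small-root with Fin.any? (Spanned? a b)
    ... | yes (y₀ , a<y₀ , y₀<b , j₀ , a∈ , b∈ , y₀∈) =
      ≤-trans (p⊆q⇒∣p∣≤∣q∣ (root⊆clique a<y₀ y₀<b a∈ b∈ y₀∈)) (M-small j₀)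
    ... | no nothing-spanned = ≤-trans (∣⊆abc∣≤3 a b c joinBag (only-abc ∘ ∈⟦⟧⁻ RootMember?)) 3≤q
      where
      only-abc : ∀ {v} → RootMember v → v ≡ a ⊎ v ≡ b ⊎ v ≡ c
      only-abc (inj₁ v≡a)                = inj₁ v≡a
      only-abc (inj₂ (inj₁ v≡b))         = inj₂ (inj₁ v≡b)
      only-abc (inj₂ (inj₂ (inj₁ v≡c)))  = inj₂ (inj₂ v≡c)
      only-abc (inj₂ (inj₂ (inj₂ sp)))   = ⊥-elim (nothing-spanned (_ , sp))

    joined-small : ∀ p → ∣ bagAt joined-tree p ∣ ≤ q
    joined-small root      = small-root
    joined-small (left p)  = L.small p
    joined-small (right p) = R.small p

    joined : Interval a b
    joined = record
      { tree         = joined-tree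
      ; within       = within
      ; a∈root       = a∈joinBag
      ; b∈root       = b∈joinBag
      ; spanned∈root = λ sp → ∈⟦⟧⁺ RootMember? (inj₂ (inj₂ (inj₂ sp)))
      ; covers       = joined-covers
      ; small        = joined-small
      ; summit       = joined-summit
      }

  Candidate : Vtx → Vtx → Vtx → Set
  Candidate a b y = a <ᶠ y × y <ᶠ b × Adj a y

  Candidate? : ∀ a b → Decidable (Candidate a b)
  Candidate? a b y = (a Fin.<? y) ×-dec (y Fin.<? b) ×-dec Adj? a y

  successor-candidate : ∀ {a b} → a <ᶠ b → toℕ b ≢ suc (toℕ a) → ∃[ y ] Candidate a b y
  successor-candidate {a} {b} a<b b≢a+1 =
    a⁺ , ≤-reflexive (sym a⁺≡a+1) , ≤-trans (≤-reflexive (cong suc a⁺≡a+1)) a+1<b , step-adjacent a⁺≡a+1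
    where
    a+1<b : suc (toℕ a) < toℕ b
    a+1<b = ≤∧≢⇒< a<b (b≢a+1 ∘ sym)
    a+1<k+1 : suc (toℕ a) < suc k
    a+1<k+1 = <-trans a+1<b (toℕ<n b)
    a⁺ : Vtx
    a⁺ = fromℕ< a+1<k+1
    a⁺≡a+1 : toℕ a⁺ ≡ suc (toℕ a)
    a⁺≡a+1 = toℕ-fromℕ< a+1<k+1

  -- Every interval [a, b] with a < b has a decomposition, by induction on b - a:
  -- a unit interval is a single bag, any other is joined at its last candidate.
  interval : ∀ fuel (a b : Vtx) → a <ᶠ b → toℕ b ∸ toℕ a ≤ fuel → Interval a b
  interval fuel a b a<b b-a≤fuel with toℕ b ℕ.≟ suc (toℕ a)
  ... | yes b≡a+1 = unit-interval a b b≡a+1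
  interval zero a b a<b b-a≤0 | no _ = ⊥-elim (<-irrefl refl (≤-trans (m<n⇒0<n∸m a<b) b-a≤0))
  interval (suc fuel) a b a<b b-a≤fuel | no b≢a+1
    with greatest (Candidate? a b) (successor-candidate a<b b≢a+1)
  ... | c , (a<c , c<b , a~c) , c-last =
    Join.joined a<c c<b a~c (λ a<y y<b a~y → c-last _ (a<y , y<b , a~y))
      (interval fuel a c a<c (≤-pred (≤-trans (∸-monoˡ-< c<b (<⇒≤ a<c)) b-a≤fuel)))
      (interval fuel c b c<b (≤-pred (≤-trans (∸-monoʳ-< a<c (<⇒≤ c<b)) b-a≤fuel)))

  record BagTree : Set where
    field
      tree   : BT
      covers : ∀ {y z} → Adj y z → ∃[ p ] (y ∈ bagAt tree p × z ∈ bagAt tree p)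
      small  : ∀ p → ∣ bagAt tree p ∣ ≤ q
      summit : ∀ u {p} → u ∈ bagAt tree p → Summit (λ p → u ∈ bagAt tree p)

  whole : BagTree
  whole with 0 <? k
  ... | yes 0<k = record
    { tree = Interval.tree chain ; covers = Interval.covers chain (in-chain _) (in-chain _)
    ; small = Interval.small chain ; summit = Interval.summit chain }
    where
    last : Vtx
    last = fromℕ< (≤-refl {suc k})
    last≡k : toℕ last ≡ k
    last≡k = toℕ-fromℕ< (≤-refl {suc k})
    chain : Interval zero last
    chain = interval k zero last (subst (0 <_) (sym last≡k) 0<k) (≤-reflexive last≡k)
    in-chain : ∀ y → Between zero last y
    in-chain y = z≤n , ≤-trans (≤-pred (toℕ<n y)) (≤-reflexive (sym last≡k))
  ... | no 0≮k = record
    { tree   = leaf ⁅ zero ⁆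
    ; covers = λ {y} {z} _ → root , subst (_∈ ⁅ zero ⁆) (sym (only-zero y)) (x∈⁅x⁆ zero)
                                  , subst (_∈ ⁅ zero ⁆) (sym (only-zero z)) (x∈⁅x⁆ zero)
    ; small  = λ { root → ≤-trans (≤-reflexive (∣⁅x⁆∣≡1 (zero {k}))) (≤-trans (s≤s z≤n) 3≤q) }
    ; summit = λ { u {root} u∈ → leaf-summit u∈ }
    }
    where
    only-zero : ∀ (y : Vtx) → y ≡ zero
    only-zero y = toℕ-injective (n≤0⇒n≡0 (≤-trans (≤-pred (toℕ<n y)) (≮⇒≥ 0≮k)))

  open BagTree whole

  T : Graph (size tree)
  T = treeGraph tree

  T-is-tree : IsTree T
  T-is-tree = treeGraph-isTree tree

  Δ : Decomposition T Adj
  Δ = record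
    { piece         = bagAt tree ∘ decode tree
    ; covers-vertex = λ u → map₂ proj₁ (encode-cover (covers {u} {cyc u} (inj₂ (inj₁ refl))))
    ; covers-pair   = λ u~v → encode-cover (covers u~v)
    ; pieces-linked = λ u x y u∈x u∈y →
                        linked-numbered tree (summit-linked (summit u {decode tree x} u∈x)) x y u∈x u∈y
    }
    where
    encode-cover : ∀ {y z} → ∃[ p ] (y ∈ bagAt tree p × z ∈ bagAt tree p) →
                   ∃[ x ] (y ∈ bagAt tree (decode tree x) × z ∈ bagAt tree (decode tree x))
    encode-cover (p , y∈ , z∈) = encode p , subst (λ p → _ ∈ bagAt tree p) (sym (decode-encode p)) y∈
                                          , subst (λ p → _ ∈ bagAt tree p) (sym (decode-encode p)) z∈

  Δ-small : ∀ x → ∣ Decomposition.piece Δ x ∣ ≤ q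
  Δ-small x = small (decode tree x)

  consecutive-adjacent : ∀ {i j} → _~_ (PathGraph (suc k)) i j → Adj i j
  consecutive-adjacent (inj₁ j≡i+1) = step-adjacent j≡i+1
  consecutive-adjacent (inj₂ i≡j+1) = Adj-sym (step-adjacent i≡j+1)

lemma3p2 : (q : ℕ) → 3 ≤ q → (k : ℕ) (H : Multigraph (suc k)) → IsNecklace q H →
           (N : ℕ) (soc : Society N (suc k)) (D : VorticalDecomposition soc) (w : ℕ) →
           width (pd D) ≡ w →
           TreeWidthAtMost (glue soc H) (q * (w + 1) ∸ 1)
lemma3p2 q 3≤q k H necklace N soc D w width≡w = _ , T , substituted , substituted-width Δ-small width≡w
  where
  open Necklace necklace 3≤q
  open Substitution T-is-tree Δ consecutive-adjacent edge-adjacent D
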